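{- Let $\Gamma$ be a finite graph with totally ordered edges, and let $d$ and $\Phi$ be the maps on its chromatic cochain groups $C^{*}(\Gamma)$ defined in the context. Then $\Phi\circ d+d\circ\Phi=0$.
   Context: Let $\Gamma$ be a finite graph (loops and multiple edges allowed) whose edges are totally ordered. States. A state is a spanning subgraph $s$ of $\Gamma$: it contains all vertices and a subset of the edges. Its dimension is its number of edges. An enhanced state $S$ is a state $s$ with a label $1$ or $x$ on each connected component of $s$. Its degree is the number of components labelled $x$. Cochain groups. $C^{i,j}(\Gamma)$ is the $\mathbb{Q}$-vector space with basis the enhanced states of dimension $i$ and degree $j$, and $C^i(\Gamma)=\bigoplus_j C^{i,j}(\Gamma)$. Sign. For an edge $e\notin s$, let $n(s,e)$ be the number of edges of $s$ smaller than $e$. The differential $d$. Set $d(S)=\sum_{e\notin s}(-1)^{n(s,e)}T_e$, where: - if both endpoints of $e$ lie in the same component of $s$, then $T_e$ is the enhanced state on $s\cup\{e\}$ with the same labels; - if $e$ joins distinct components labelled $a,b$, then the merged component is labelled $ab$ computed in $\mathbb{Q}[x]/(x^2)$ (so $1\cdot1=1$, $1\cdot x=x\cdot 1=x$, $x\cdot x=0$, and the term is $0$ if $ab=0$), with the other labels unchanged. Thus $d\colon C^{i,j}\to C^{i+1,j}$. The map $\Phi$. Set $\Phi(S)=\sum(-1)^{n(s,e)}U_e$, summed over the edges $e\notin s$ joining two distinct components of $s$ both labelled $x$. Here $U_e$ is the enhanced state on $s\cup\{e\}$ with the merged component labelled $1$ and the other labels unchanged. -}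

module Defs where

open import Data.Nat using (ℕ; zero; suc)
open import Data.Bool using (Bool; true; false; _∧_; _∨_; not; if_then_else_; T)
import Data.Bool as B
open import Data.Fin using (Fin; toℕ)
import Data.Fin as F
open import Data.Fin.Properties using () renaming (_≟_ to _≟ᶠ_)
open import Data.Vec using (Vec; lookup; tabulate; _[_]≔_)
open import Data.Vec.Properties using (≡-dec)
open import Data.List using (List; []; _∷_; _++_; map; concatMap; foldr; allFin; filter)
open import Data.Product using (Σ; _×_; _,_; proj₁; proj₂)
open import Data.Rational using (ℚ; 0ℚ; 1ℚ; _+_; _*_; -_)
open import Relation.Nullary using (Dec; yes; no; does)
open import Relation.Nullary.Decidable using (T?)
open import Data.Product.Properties using () renaming (≡-dec to ×-≡-dec)
open import Data.List.Relation.Unary.All using (All)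
import Data.List
open import Relation.Binary.PropositionalEquality using (_≡_)

-- A finite graph: n vertices, m edges; edge e has endpoints (ends e).
-- Loops (equal endpoints) and multiple edges are allowed.
-- The total order on edges is the order of their indices in Fin m.
record Graph : Set where
  field
    n    : ℕ
    m    : ℕ
    ends : Fin m → Fin n × Fin n

open Graph public

-- A state: the spanning subgraph with edge set {e | s[e] = true}.
State : Graph → Set
State Γ = Vec Bool (m Γ)

_==_ : ∀ {k} → Fin k → Fin k → Bool
u == v = does (u ≟ᶠ v)

anyL : ∀ {A : Set} → (A → Bool) → List A → Bool
anyL p []       = false
anyL p (x ∷ xs) = p x ∨ anyL p xs

step : (Γ : Graph) → State Γ → Vec Bool (n Γ) → Vec Bool (n Γ)
step Γ s R = tabulate λ w → lookup R w ∨
  anyL (λ e → lookup s e ∧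
          ((lookup R (proj₁ (ends Γ e)) ∧ (proj₂ (ends Γ e) == w)) ∨
           (lookup R (proj₂ (ends Γ e)) ∧ (proj₁ (ends Γ e) == w))))
       (allFin (m Γ))

iterate : ∀ {A : Set} → ℕ → (A → A) → A → A
iterate zero    f a = a
iterate (suc k) f a = f (iterate k f a)

-- the vertex set of the connected component of s containing u
-- (n iterations suffice to saturate)
component : (Γ : Graph) → State Γ → Fin (n Γ) → Vec Bool (n Γ)
component Γ s u = iterate (n Γ) (step Γ s) (tabulate λ w → u == w)

conn : (Γ : Graph) → State Γ → Fin (n Γ) → Fin (n Γ) → Bool
conn Γ s u v = lookup (component Γ s u) v

-- An enhanced state: a state s with a labelling of vertices by
-- Bool (true = x, false = 1) that is constant on connected components of s;
-- this is exactly a labelling of the components of s.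
Labels : Graph → Set
Labels Γ = Vec Bool (n Γ)

EState : Graph → Set
EState Γ = State Γ × Labels Γ

ValidE : (Γ : Graph) → EState Γ → Set
ValidE Γ (s , ℓ) = ∀ u v → T (conn Γ s u v) → lookup ℓ u ≡ lookup ℓ v

_≟E_ : ∀ {Γ} (S S′ : EState Γ) → Dec (S ≡ S′)
_≟E_ = ×-≡-dec (≡-dec B._≟_) (≡-dec B._≟_)

-- Cochains: finite formal ℚ-linear combinations of enhanced states,
-- represented as lists of (coefficient, enhanced state).
Cochain : Graph → Set
Cochain Γ = List (ℚ × EState Γ)

coeff : ∀ {Γ} → EState Γ → Cochain Γ → ℚ
coeff T []              = 0ℚ
coeff {Γ} T ((q , S) ∷ c) = (if does (_≟E_ {Γ} S T) then q else 0ℚ) + coeff {Γ} T c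

ValidC : (Γ : Graph) → Cochain Γ → Set
ValidC Γ c = All (λ qS → ValidE Γ (proj₂ qS)) c

sgn : ℕ → ℚ
sgn zero    = 1ℚ
sgn (suc k) = - (sgn k)

count< : ∀ {k} → Vec Bool k → Fin k → ℕ
count< s e = Data.List.length (filter (λ i → (T? (lookup s i ∧ does (i F.<? e)))) (allFin _))

relabel : (Γ : Graph) → State Γ → Labels Γ → Fin (n Γ) → Fin (n Γ) → Bool → Labels Γ
relabel Γ s ℓ u v a = tabulate λ w → if conn Γ s u w ∨ conn Γ s v w then a else lookup ℓ w

dTerm : (Γ : Graph) → EState Γ → Fin (m Γ) → Cochain Γ
dTerm Γ (s , ℓ) e with lookup s e
... | true  = []
... | false with conn Γ s (proj₁ (ends Γ e)) (proj₂ (ends Γ e))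
...   | true  = (sgn (count< s e) , (s [ e ]≔ true) , ℓ) ∷ []
...   | false with lookup ℓ (proj₁ (ends Γ e)) ∧ lookup ℓ (proj₂ (ends Γ e))
...     | true  = []     -- x · x = 0
...     | false = (sgn (count< s e) ,
                   (s [ e ]≔ true) ,
                   relabel Γ s ℓ (proj₁ (ends Γ e)) (proj₂ (ends Γ e))
                     (lookup ℓ (proj₁ (ends Γ e)) ∨ lookup ℓ (proj₂ (ends Γ e)))) ∷ []

ΦTerm : (Γ : Graph) → EState Γ → Fin (m Γ) → Cochain Γ
ΦTerm Γ (s , ℓ) e with lookup s e
... | true  = []
... | false with conn Γ s (proj₁ (ends Γ e)) (proj₂ (ends Γ e))
...   | true  = []
...   | false with lookup ℓ (proj₁ (ends Γ e)) ∧ lookup ℓ (proj₂ (ends Γ e))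
...     | false = []
...     | true  = (sgn (count< s e) ,
                   (s [ e ]≔ true) ,
                   relabel Γ s ℓ (proj₁ (ends Γ e)) (proj₂ (ends Γ e)) false) ∷ []

scale : ∀ {Γ} → ℚ → Cochain Γ → Cochain Γ
scale q = map (λ rS → (q * proj₁ rS , proj₂ rS))

dBasis : (Γ : Graph) → EState Γ → Cochain Γ
dBasis Γ S = concatMap (dTerm Γ S) (allFin (m Γ))

ΦBasis : (Γ : Graph) → EState Γ → Cochain Γ
ΦBasis Γ S = concatMap (ΦTerm Γ S) (allFin (m Γ))

d : (Γ : Graph) → Cochain Γ → Cochain Γ
d Γ = concatMap (λ qS → scale {Γ} (proj₁ qS) (dBasis Γ (proj₂ qS)))

Φ : (Γ : Graph) → Cochain Γ → Cochain Γ
Φ Γ = concatMap (λ qS → scale {Γ} (proj₁ qS) (ΦBasis Γ (proj₂ qS)))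

{-# OPTIONS --safe #-}

-- Expanding Φ ∘ d + d ∘ Φ on a basis state (s, ℓ) gives a double sum over ordered pairs (e, f)
-- of distinct edges outside s: e is added first and f second, once by Φ after d and once by
-- d after Φ. The signs of (e, f) and (f, e) are opposite, since adding e shifts the position
-- of f by one exactly when e < f. The labellings of s + e + f reached through (e, f) and
-- through (f, e) are the same: at a vertex w they only depend on how w and the four endpoints
-- of e and f are connected and labelled in (s, ℓ), and on these five points the claim is
-- checked exhaustively. So the double sum is antisymmetric, hence zero.

module Submission where

open import Defs
open import Data.List using (_++_)
open import Data.Rational using (0ℚ)
open import Relation.Binary.PropositionalEquality using (_≡_)

open import Algebra.Bundles using (CommutativeMonoid)
open import Data.Bool using (Bool; true; false; _∧_; _∨_; not; if_then_else_; T)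
import Data.Bool as Bool
open import Data.Bool.Properties using (T?; T-≡; T-∧; T-∨; if-float)
open import Data.Empty using (⊥; ⊥-elim)
open import Data.Fin using (Fin; zero; suc; _<?_)
open import Data.Fin.Properties using (<-cmp; <-asym; suc-injective) renaming (_≟_ to _≟ᶠ_)
open import Data.Fin.Subset using (Subset; _∈_; _⊆_; _⊂_; Nonempty; ∣_∣; ∁)
open import Data.Fin.Subset.Properties
  using (_∈?_; _⊂?_; ⊆-antisym; p⊂q⇒∣p∣<∣q∣; ∣p∣≤n; ⊥⊆; ∉⊥; ∣⊥∣≡0)
open import Data.List using (List; []; _∷_; map; concatMap; allFin; length; filter)
import Data.List as List using (tabulate)
open import Data.List.Membership.Propositional.Properties using (∈-allFin)
open import Data.List.Properties using (∷-injectiveˡ; ∷-injectiveʳ) renaming (≡-dec to List-≡-dec)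
open import Data.List.Relation.Binary.Pointwise as Pointwise
  using (Pointwise; []; _∷_; ++⁺; concat⁺; map⁺; Pointwise-≡⇒≡)
open import Data.List.Relation.Unary.All as All using (All; []; _∷_)
open import Data.List.Relation.Unary.Any using (Any; here; there)
open import Data.Maybe using (Maybe; just; nothing)
open import Data.Nat using (ℕ; zero; suc; _≤_; _<_) renaming (_+_ to _+ℕ_)
open import Data.Nat.Properties using (≤-<-trans; <-irrefl; +-suc)
open import Data.Product using (∃-syntax; _×_; _,_; proj₁; proj₂; map₂)
open import Data.Rational using (ℚ; 1ℚ; ½; _+_; _*_; -_)
open import Data.Rational.Properties
  using (+-assoc; +-identityˡ; +-inverseʳ; *-assoc; *-comm; *-identityˡ; *-identityʳ; *-zeroʳ;
         *-distribˡ-+; *-distribʳ-+; neg-distrib-+; neg-distribʳ-*; neg-distribˡ-*;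
         +-0-group; +-0-commutativeMonoid)
open import Algebra.Properties.Group +-0-group using (⁻¹-involutive)
open import Algebra.Properties.CommutativeSemigroup (CommutativeMonoid.commutativeSemigroup +-0-commutativeMonoid)
  using (interchange)
open import Data.Sum using (_⊎_; inj₁; inj₂)
open import Data.Unit using (tt)
open import Data.Vec using (Vec; []; _∷_; lookup; tabulate; _[_]≔_)
open import Data.Vec.Properties
  using (lookup∘tabulate; tabulate∘lookup; tabulate-cong; lookup∘update; lookup∘update′; []≔-commutes;
         lookup-map; []=⇒lookup; lookup⇒[]=; ≡-dec)
open import Function using (_∘_)
open import Function.Bundles using (Equivalence)
open import Relation.Binary using (tri<; tri≈; tri>)
open import Relation.Binary.PropositionalEquality
  using (refl; sym; trans; cong; cong₂; subst; _≢_; module ≡-Reasoning)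
open import Relation.Nullary using (Dec; yes; no; does)
open import Relation.Nullary.Decidable
  using (map′; _×-dec_; _→-dec_; from-yes; decidable-stable; dec-true; dec-false)

open ≡-Reasoning
open Equivalence using (to; from)

private variable
  A B C D : Set

T-ext : ∀ {a b} → (T a → T b) → (T b → T a) → a ≡ b
T-ext {false} {false} _ _ = refl
T-ext {false} {true}  _ g = ⊥-elim (g tt)
T-ext {true}  {false} f _ = ⊥-elim (f tt)
T-ext {true}  {true}  _ _ = refl

true-or-false : ∀ b → b ≡ true ⊎ b ≡ false
true-or-false true  = inj₁ refl
true-or-false false = inj₂ refl

==-refl : ∀ {k} (u : Fin k) → T (u == u)
==-refl u = from T-≡ (dec-true (u ≟ᶠ u) refl)

==⇒≡ : ∀ {k} {u v : Fin k} → T (u == v) → u ≡ v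
==⇒≡ {u = u} {v} h with u ≟ᶠ v
... | yes u≡v = u≡v

T-anyL⁻ : ∀ (p : A → Bool) xs → T (anyL p xs) → ∃[ x ] T (p x)
T-anyL⁻ p (x ∷ xs) h with to T-∨ h
... | inj₁ px = x , px
... | inj₂ rest = T-anyL⁻ p xs rest

T-anyL-allFin⁺ : ∀ {k} (p : Fin k → Bool) x → T (p x) → T (anyL p (allFin k))
T-anyL-allFin⁺ p x px = go (∈-allFin x)
  where
  go : ∀ {xs} → Any (x ≡_) xs → T (anyL p xs)
  go (here refl) = from T-∨ (inj₁ px)
  go (there x∈xs) = from T-∨ (inj₂ (go x∈xs))

when : Bool → A → List A
when b x = if b then x ∷ [] else []

when⁺ : ∀ {R : A → B → Set} {b b′ x y} → b ≡ b′ → R x y → Pointwise R (when b x) (when b′ y)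
when⁺ {b = true}  refl r = r ∷ []
when⁺ {b = false} refl r = []

concatMap⁺ : ∀ {R : A → B → Set} {S : C → D → Set} {f : A → List C} {g : B → List D} →
             (∀ {x y} → R x y → Pointwise S (f x) (g y)) →
             ∀ {xs ys} → Pointwise R xs ys → Pointwise S (concatMap f xs) (concatMap g ys)
concatMap⁺ f∼g xs∼ys = concat⁺ (map⁺ _ _ (Pointwise.map f∼g xs∼ys))

concatMap-[] : ∀ {F : A → List B} → (∀ x → F x ≡ []) → ∀ xs → concatMap F xs ≡ []
concatMap-[] F≡[] []       = refl
concatMap-[] F≡[] (x ∷ xs) rewrite F≡[] x = concatMap-[] F≡[] xs

vec-ext : ∀ {k} {u v : Vec A k} → (∀ i → lookup u i ≡ lookup v i) → u ≡ v
vec-ext {u = u} {v} h = trans (sym (tabulate∘lookup u)) (trans (tabulate-cong h) (tabulate∘lookup v))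

-- The index i₀ rules out vectors of length 0, whose columns do not determine the length of the list.
columns-injective : ∀ {k} → Fin k → {xs ys : List (Vec A k)} →
                    (∀ i → map (λ v → lookup v i) xs ≡ map (λ v → lookup v i) ys) → xs ≡ ys
columns-injective i₀ {[]}     {[]}     _ = refl
columns-injective i₀ {[]}     {y ∷ ys} h with () ← h i₀
columns-injective i₀ {x ∷ xs} {[]}     h with () ← h i₀
columns-injective i₀ {x ∷ xs} {y ∷ ys} h =
  cong₂ _∷_ (vec-ext (λ i → ∷-injectiveˡ (h i))) (columns-injective i₀ (λ i → ∷-injectiveʳ (h i)))

∑ : List A → (A → ℚ) → ℚ
∑ []       g = 0ℚ
∑ (x ∷ xs) g = g x + ∑ xs g

infix 5 ∑
syntax ∑ xs (λ x → t) = ∑[ x ∈ xs ] t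

∑-cong : ∀ (xs : List A) {g h : A → ℚ} → (∀ x → g x ≡ h x) → ∑ xs g ≡ ∑ xs h
∑-cong []       _  = refl
∑-cong (x ∷ xs) eq = cong₂ _+_ (eq x) (∑-cong xs eq)

∑-++ : ∀ (xs ys : List A) g → ∑ (xs ++ ys) g ≡ ∑ xs g + ∑ ys g
∑-++ []       ys g = sym (+-identityˡ _)
∑-++ (x ∷ xs) ys g = trans (cong (g x +_) (∑-++ xs ys g)) (sym (+-assoc (g x) _ _))

∑-+ : ∀ (xs : List A) g h → ∑[ x ∈ xs ] (g x + h x) ≡ ∑ xs g + ∑ xs h
∑-+ []       g h = sym (+-identityˡ 0ℚ)
∑-+ (x ∷ xs) g h = trans (cong (g x + h x +_) (∑-+ xs g h)) (interchange (g x) (h x) _ _)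

∑-*ˡ : ∀ q (xs : List A) g → ∑[ x ∈ xs ] (q * g x) ≡ q * ∑ xs g
∑-*ˡ q []       g = sym (*-zeroʳ q)
∑-*ˡ q (x ∷ xs) g = trans (cong (q * g x +_) (∑-*ˡ q xs g)) (sym (*-distribˡ-+ q (g x) _))

∑-neg : ∀ (xs : List A) g → ∑[ x ∈ xs ] (- g x) ≡ - ∑ xs g
∑-neg []       g = refl
∑-neg (x ∷ xs) g = trans (cong (- g x +_) (∑-neg xs g)) (sym (neg-distrib-+ (g x) _))

∑-zero : ∀ (xs : List A) → ∑[ x ∈ xs ] 0ℚ ≡ 0ℚ
∑-zero []       = refl
∑-zero (x ∷ xs) = trans (cong (0ℚ +_) (∑-zero xs)) (+-identityˡ 0ℚ)

∑-swap : ∀ (xs : List A) (ys : List B) (h : A → B → ℚ) →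
         ∑[ x ∈ xs ] ∑[ y ∈ ys ] h x y ≡ ∑[ y ∈ ys ] ∑[ x ∈ xs ] h x y
∑-swap []       ys h = sym (∑-zero ys)
∑-swap (x ∷ xs) ys h = trans (cong (∑ ys (h x) +_) (∑-swap xs ys h)) (sym (∑-+ ys (h x) _))

∑-map : ∀ (f : A → B) xs g → ∑ (map f xs) g ≡ ∑[ x ∈ xs ] g (f x)
∑-map f []       g = refl
∑-map f (x ∷ xs) g = cong (g (f x) +_) (∑-map f xs g)

∑-concatMap : ∀ (F : A → List B) xs g → ∑ (concatMap F xs) g ≡ ∑[ x ∈ xs ] ∑ (F x) g
∑-concatMap F []       g = refl
∑-concatMap F (x ∷ xs) g = trans (∑-++ (F x) (concatMap F xs) g) (cong (∑ (F x) g +_) (∑-concatMap F xs g))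

x≡-x⇒x≡0 : ∀ x → x ≡ - x → x ≡ 0ℚ
x≡-x⇒x≡0 x x≡-x = begin
  x               ≡⟨ sym (*-identityˡ x) ⟩
  (½ + ½) * x     ≡⟨ *-distribʳ-+ x ½ ½ ⟩
  ½ * x + ½ * x   ≡⟨ sym (*-distribˡ-+ ½ x x) ⟩
  ½ * (x + x)     ≡⟨ cong (λ y → ½ * (x + y)) x≡-x ⟩
  ½ * (x + - x)   ≡⟨ cong (½ *_) (+-inverseʳ x) ⟩
  ½ * 0ℚ          ≡⟨ *-zeroʳ ½ ⟩
  0ℚ              ∎

∑-antisym : ∀ (xs : List A) (t : A → A → ℚ) → (∀ x y → t x y ≡ - t y x) →
            ∑[ x ∈ xs ] ∑[ y ∈ xs ] t x y ≡ 0ℚ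
∑-antisym xs t anti = x≡-x⇒x≡0 _ (begin
  ∑[ x ∈ xs ] ∑[ y ∈ xs ] t x y       ≡⟨ ∑-cong xs (λ x → ∑-cong xs (anti x)) ⟩
  ∑[ x ∈ xs ] ∑[ y ∈ xs ] - t y x     ≡⟨ ∑-cong xs (λ x → ∑-neg xs (λ y → t y x)) ⟩
  ∑[ x ∈ xs ] - (∑[ y ∈ xs ] t y x)   ≡⟨ ∑-neg xs _ ⟩
  - (∑[ x ∈ xs ] ∑[ y ∈ xs ] t y x)   ≡⟨ cong -_ (∑-swap xs xs (λ x y → t y x)) ⟩
  - (∑[ y ∈ xs ] ∑[ x ∈ xs ] t y x)   ∎)

⟨_∣_⟩ : (A → ℚ) → List (ℚ × A) → ℚ
⟨ g ∣ c ⟩ = ∑[ qS ∈ c ] proj₁ qS * g (proj₂ qS)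

pairing-++ : ∀ (g : A → ℚ) c c′ → ⟨ g ∣ c ++ c′ ⟩ ≡ ⟨ g ∣ c ⟩ + ⟨ g ∣ c′ ⟩
pairing-++ g c c′ = ∑-++ c c′ _

pairing-cong : ∀ (c : List (ℚ × A)) {g h} → (∀ S → g S ≡ h S) → ⟨ g ∣ c ⟩ ≡ ⟨ h ∣ c ⟩
pairing-cong c eq = ∑-cong c (λ qS → cong (proj₁ qS *_) (eq (proj₂ qS)))

pairing-+ : ∀ (c : List (ℚ × A)) g h → ⟨ (λ S → g S + h S) ∣ c ⟩ ≡ ⟨ g ∣ c ⟩ + ⟨ h ∣ c ⟩
pairing-+ c g h = trans (∑-cong c (λ qS → *-distribˡ-+ (proj₁ qS) _ _)) (∑-+ c _ _)

pairing-vanishes : ∀ {g : A → ℚ} {c} → All (λ qS → g (proj₂ qS) ≡ 0ℚ) c → ⟨ g ∣ c ⟩ ≡ 0ℚ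
pairing-vanishes []                  = refl
pairing-vanishes {c = (q , _) ∷ _} (g≡0 ∷ rest) =
  trans (cong₂ _+_ (trans (cong (q *_) g≡0) (*-zeroʳ q)) (pairing-vanishes rest)) (+-identityˡ 0ℚ)

-- Signs

countᶠ : ∀ {k} → (Fin k → Bool) → ℕ
countᶠ {zero}  p = 0
countᶠ {suc k} p = (if p zero then 1 else 0) +ℕ countᶠ (p ∘ suc)

countᶠ-cong : ∀ {k} (p q : Fin k → Bool) → (∀ i → p i ≡ q i) → countᶠ p ≡ countᶠ q
countᶠ-cong {zero}  p q eq = refl
countᶠ-cong {suc k} p q eq =
  cong₂ _+ℕ_ (cong (if_then 1 else 0) (eq zero)) (countᶠ-cong (p ∘ suc) (q ∘ suc) (eq ∘ suc))

countᶠ-insert : ∀ {k} (p q : Fin k → Bool) e → (∀ i → i ≢ e → p i ≡ q i) → q e ≡ false →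
                countᶠ p ≡ (if p e then 1 else 0) +ℕ countᶠ q
countᶠ-insert {suc k} p q zero agree qe rewrite qe =
  cong (_ +ℕ_) (countᶠ-cong (p ∘ suc) (q ∘ suc) (λ i → agree (suc i) λ ()))
countᶠ-insert {suc k} p q (suc e) agree qe rewrite agree zero (λ ())
  with p (suc e) | countᶠ-insert (p ∘ suc) (q ∘ suc) e (λ i i≢e → agree (suc i) (i≢e ∘ suc-injective)) qe
... | true  | ih = trans (cong (_ +ℕ_) ih) (+-suc _ _)
... | false | ih = cong (_ +ℕ_) ih

length-filter-tabulate : ∀ k (h : Fin k → A) (p : A → Bool) →
                         length (filter (λ x → T? (p x)) (List.tabulate h)) ≡ countᶠ (p ∘ h)
length-filter-tabulate zero    h p = refl
length-filter-tabulate (suc k) h p with p (h zero)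
... | true  = cong suc (length-filter-tabulate k (h ∘ suc) p)
... | false = length-filter-tabulate k (h ∘ suc) p

count<-insert : ∀ {k} (s : Vec Bool k) {e} f → lookup s e ≡ false →
                count< (s [ e ]≔ true) f ≡ (if does (e <? f) then 1 else 0) +ℕ count< s f
count<-insert {k} s {e} f e∉s
  rewrite length-filter-tabulate k (λ i → i) (λ i → lookup (s [ e ]≔ true) i ∧ does (i <? f))
        | length-filter-tabulate k (λ i → i) (λ i → lookup s i ∧ does (i <? f)) =
  trans (countᶠ-insert _ _ e (λ i i≢e → cong (_∧ does (i <? f)) (lookup∘update′ i≢e s true))
                              (cong (_∧ does (e <? f)) e∉s))
        (cong (λ b → (if b ∧ does (e <? f) then 1 else 0) +ℕ _) (lookup∘update e s true))

pairSign : ∀ {k} → Vec Bool k → Fin k → Fin k → ℚ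
pairSign s e f = sgn (count< s e) * sgn (count< (s [ e ]≔ true) f)

pairSign-antisym : ∀ {k} {s : Vec Bool k} {e f} → lookup s e ≡ false → lookup s f ≡ false → e ≢ f →
                   pairSign s e f ≡ - pairSign s f e
pairSign-antisym {s = s} {e} {f} e∉s f∉s e≢f
  rewrite count<-insert s f e∉s | count<-insert s e f∉s with <-cmp e f
... | tri< e<f _ _ rewrite dec-true (e <? f) e<f | dec-false (f <? e) (<-asym e<f) =
  trans (sym (neg-distribʳ-* (sgn (count< s e)) _)) (cong -_ (*-comm (sgn (count< s e)) _))
... | tri≈ _ e≡f _ = ⊥-elim (e≢f e≡f)
... | tri> _ _ f<e rewrite dec-false (e <? f) (<-asym f<e) | dec-true (f <? e) f<e =
  trans (*-comm (sgn (count< s e)) _)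
        (trans (sym (⁻¹-involutive _)) (cong -_ (neg-distribʳ-* (sgn (count< s f)) _)))

-- Saturation of inflationary maps on finite subsets

⊆∧≢⇒⊂ : ∀ {k} {p q : Subset k} → p ⊆ q → p ≢ q → p ⊂ q
⊆∧≢⇒⊂ {p = p} {q} p⊆q p≢q with p ⊂? q
... | yes p⊂q = p⊂q
... | no  p⊄q = ⊥-elim (p≢q (⊆-antisym p⊆q q⊆p))
  where
  q⊆p : q ⊆ p
  q⊆p {x} x∈q = decidable-stable (x ∈? p) (λ x∉p → p⊄q (p⊆q , x , x∈q , x∉p))

nonempty⇒∣p∣>0 : ∀ {k} {p : Subset k} → Nonempty p → 0 < ∣ p ∣
nonempty⇒∣p∣>0 {k} {p} (x , x∈p) = subst (_< ∣ p ∣) (∣⊥∣≡0 k) (p⊂q⇒∣p∣<∣q∣ (⊥⊆ , x , x∈p , ∉⊥))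

module _ {k} (f : Subset k → Subset k) (f-inflationary : ∀ p → p ⊆ f p) where

  private
    fixed-or-growing : ∀ p → Nonempty p → ∀ j →
                       f (iterate j f p) ≡ iterate j f p ⊎ suc j ≤ ∣ iterate j f p ∣
    fixed-or-growing p p≠∅ zero = inj₂ (nonempty⇒∣p∣>0 p≠∅)
    fixed-or-growing p p≠∅ (suc j) with fixed-or-growing p p≠∅ j
    ... | inj₁ fixed = inj₁ (cong f fixed)
    ... | inj₂ grown with ≡-dec Bool._≟_ (f (iterate j f p)) (iterate j f p)
    ...   | yes fixed = inj₁ (cong f fixed)
    ...   | no  moved = inj₂ (≤-<-trans grown (p⊂q⇒∣p∣<∣q∣ (⊆∧≢⇒⊂ (f-inflationary _) (moved ∘ sym))))

  -- A strictly increasing chain of subsets of a k-element set starting from a nonempty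
  -- set has fewer than k steps.
  iterate-saturates : ∀ p → Nonempty p → f (iterate k f p) ≡ iterate k f p
  iterate-saturates p p≠∅ with fixed-or-growing p p≠∅ k
  ... | inj₁ fixed = fixed
  ... | inj₂ grown = ⊥-elim (<-irrefl refl (≤-<-trans (∣p∣≤n (iterate k f p)) grown))

∈⇒T : ∀ {k} {p : Subset k} {x} → x ∈ p → T (lookup p x)
∈⇒T x∈p = from T-≡ ([]=⇒lookup x∈p)

T⇒∈ : ∀ {k} {p : Subset k} {x} → T (lookup p x) → x ∈ p
T⇒∈ {p = p} {x} h = lookup⇒[]= x p (to T-≡ h)

-- The connectivity and the labels of an enhanced state, seen on a set P of chosen vertices.
record LocalState (P : Set) : Set where
  field
    linked : P → P → Bool
    label  : P → Bool

open LocalState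

module _ {P : Set} where

  joined : P → P → (P → P → Bool) → P → P → Bool
  joined i j c x y = c x y ∨ (c x i ∧ c j y) ∨ (c x j ∧ c i y)

  joined-congʳ : ∀ {i j y y′} (c : P → P → Bool) a →
                 (∀ x → c x y ≡ c x y′) → joined i j c a y ≡ joined i j c a y′
  joined-congʳ {i} {j} c a eq =
    cong₂ _∨_ (eq a) (cong₂ _∨_ (cong (c a i ∧_) (eq j)) (cong (c a j ∧_) (eq i)))

  joined-ends : ∀ {i j} (c : P → P → Bool) a → T (c i i) → T (c j j) →
                joined i j c a i ≡ joined i j c a j
  joined-ends {i} {j} c a ii jj rewrite to T-≡ ii | to T-≡ jj with c a i | c a j
  ... | false | false = refl
  ... | false | true  = refl
  ... | true  | false = refl
  ... | true  | true  = refl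

  dᴸ : P → P → LocalState P → List (LocalState P)
  dᴸ i j σ = when (linked σ i j ∨ not (label σ i ∧ label σ j)) record
    { linked = joined i j (linked σ)
    ; label  = λ x → if linked σ i j then label σ x
                     else if linked σ i x ∨ linked σ j x then label σ i ∨ label σ j else label σ x
    }

  Φᴸ : P → P → LocalState P → List (LocalState P)
  Φᴸ i j σ = when (not (linked σ i j) ∧ (label σ i ∧ label σ j)) record
    { linked = joined i j (linked σ)
    ; label  = λ x → if linked σ i x ∨ linked σ j x then false else label σ x
    }

  twoStepᴸ : P → P → P → P → LocalState P → List (LocalState P)
  twoStepᴸ i j i′ j′ σ = concatMap (Φᴸ i′ j′) (dᴸ i j σ) ++ concatMap (dᴸ i′ j′) (Φᴸ i j σ)

  Consistent : LocalState P → Set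
  Consistent σ = (∀ x y z → T (linked σ x y) → T (linked σ y z) → T (linked σ x z))
               × (∀ x y → T (linked σ x y) → label σ x ≡ label σ y)

  extend : LocalState P → (P → Bool) → Bool → LocalState (Maybe P)
  extend σ lw ℓw = record
    { linked = λ where
        (just x) (just y) → linked σ x y
        (just x) nothing  → lw x
        nothing  (just y) → lw y
        nothing  nothing  → true
    ; label = λ where
        (just x) → label σ x
        nothing  → ℓw
    }

-- The exhaustive check on five points

data Endpoint : Set where
  e₁ e₂ f₁ f₂ : Endpoint

-- The endpoints of two edges e and f, and a probe vertex w (nothing).
Corner : Set
Corner = Maybe Endpoint

frameOf : Vec Bool 10 → LocalState Endpoint
frameOf (ee ∷ e₁f₁ ∷ e₁f₂ ∷ e₂f₁ ∷ e₂f₂ ∷ ff ∷ le₁ ∷ le₂ ∷ lf₁ ∷ lf₂ ∷ []) = record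
  { linked = λ where
      e₁ e₁ → true ; e₁ e₂ → ee   ; e₁ f₁ → e₁f₁ ; e₁ f₂ → e₁f₂
      e₂ e₁ → ee   ; e₂ e₂ → true ; e₂ f₁ → e₂f₁ ; e₂ f₂ → e₂f₂
      f₁ e₁ → e₁f₁ ; f₁ e₂ → e₂f₁ ; f₁ f₁ → true ; f₁ f₂ → ff
      f₂ e₁ → e₁f₂ ; f₂ e₂ → e₂f₂ ; f₂ f₁ → ff   ; f₂ f₂ → true
  ; label = λ where
      e₁ → le₁ ; e₂ → le₂ ; f₁ → lf₁ ; f₂ → lf₂
  }

probeOf : LocalState Endpoint → Vec Bool 5 → LocalState Corner
probeOf σ (we₁ ∷ we₂ ∷ wf₁ ∷ wf₂ ∷ ℓw ∷ []) =
  extend σ (λ where e₁ → we₁ ; e₂ → we₂ ; f₁ → wf₁ ; f₂ → wf₂) ℓw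

probeLabels : List (LocalState Corner) → List Bool
probeLabels = map (λ τ → label τ nothing)

Commutes : LocalState Corner → Set
Commutes σ = probeLabels (twoStepᴸ (just e₁) (just e₂) (just f₁) (just f₂) σ)
           ≡ probeLabels (twoStepᴸ (just f₁) (just f₂) (just e₁) (just e₂) σ)

private
  ∀-endpoint? : {Q : Endpoint → Set} → (∀ x → Dec (Q x)) → Dec (∀ x → Q x)
  ∀-endpoint? Q? = map′ (λ { (a , b , c , d) → λ { e₁ → a ; e₂ → b ; f₁ → c ; f₂ → d } })
                        (λ h → h e₁ , h e₂ , h f₁ , h f₂)
                        (Q? e₁ ×-dec Q? e₂ ×-dec Q? f₁ ×-dec Q? f₂)

  ∀-corner? : {Q : Corner → Set} → (∀ x → Dec (Q x)) → Dec (∀ x → Q x)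
  ∀-corner? Q? = map′ (λ { (onJust , _) (just x) → onJust x ; (_ , onNothing) nothing → onNothing })
                      (λ h → (h ∘ just) , h nothing)
                      (∀-endpoint? (Q? ∘ just) ×-dec Q? nothing)

  ∀-bits? : ∀ k {Q : Vec Bool k → Set} → (∀ bs → Dec (Q bs)) → Dec (∀ bs → Q bs)
  ∀-bits? zero    Q? = map′ (λ { q [] → q }) (λ h → h []) (Q? [])
  ∀-bits? (suc k) Q? = map′ (λ { (t , f) (true ∷ bs) → t bs ; (t , f) (false ∷ bs) → f bs })
                            (λ h → (h ∘ (true ∷_)) , (h ∘ (false ∷_)))
                            (∀-bits? k (Q? ∘ (true ∷_)) ×-dec ∀-bits? k (Q? ∘ (false ∷_)))

  consistent? : {P : Set} → ({Q : P → Set} → (∀ x → Dec (Q x)) → Dec (∀ x → Q x)) →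
                (σ : LocalState P) → Dec (Consistent σ)
  consistent? ∀? σ =
    ∀? (λ x → ∀? λ y → ∀? λ z →
          T? (linked σ x y) →-dec T? (linked σ y z) →-dec T? (linked σ x z))
    ×-dec ∀? (λ x → ∀? λ y → T? (linked σ x y) →-dec label σ x Bool.≟ label σ y)

  commutes? : ∀ σ → Dec (Commutes σ)
  commutes? σ = List-≡-dec Bool._≟_ (probeLabels (twoStepᴸ (just e₁) (just e₂) (just f₁) (just f₂) σ))
                                     (probeLabels (twoStepᴸ (just f₁) (just f₂) (just e₁) (just e₂) σ))

-- Stated in two stages so that the search only visits probes of consistent frames.
twoStepᴸ-comm : ∀ fb → Consistent (frameOf fb) →
                ∀ pb → Consistent (probeOf (frameOf fb) pb) → Commutes (probeOf (frameOf fb) pb)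
twoStepᴸ-comm = from-yes
  (∀-bits? 10 λ fb → consistent? ∀-endpoint? (frameOf fb) →-dec
   ∀-bits? 5  λ pb → consistent? ∀-corner? (probeOf (frameOf fb) pb) →-dec
                     commutes? (probeOf (frameOf fb) pb))

-- Connectivity

module _ (Γ : Graph) where

  Vertex Edge : Set
  Vertex = Fin (n Γ)
  Edge   = Fin (m Γ)

  src tgt : Edge → Vertex
  src e = proj₁ (ends Γ e)
  tgt e = proj₂ (ends Γ e)

  edges : List Edge
  edges = allFin (m Γ)

  Closed : State Γ → Subset (n Γ) → Set
  Closed s C = ∀ e → T (lookup s e) → lookup C (src e) ≡ lookup C (tgt e)

  module _ (s : State Γ) where

    private
      adjoins : Subset (n Γ) → Vertex → Edge → Bool
      adjoins R x e = lookup s e ∧ ((lookup R (src e) ∧ (tgt e == x)) ∨ (lookup R (tgt e) ∧ (src e == x)))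

      lookup-step : ∀ R x → lookup (step Γ s R) x ≡ (lookup R x ∨ anyL (adjoins R x) edges)
      lookup-step R x = lookup∘tabulate _ x

    step-inflationary : ∀ R {x} → T (lookup R x) → T (lookup (step Γ s R) x)
    step-inflationary R {x} h = subst T (sym (lookup-step R x)) (from T-∨ (inj₁ h))

    private
      step-along : ∀ R e {x} → T (adjoins R x e) → T (lookup (step Γ s R) x)
      step-along R e {x} h =
        subst T (sym (lookup-step R x)) (from T-∨ (inj₂ (T-anyL-allFin⁺ (adjoins R x) e h)))

    step-forward : ∀ R e → T (lookup s e) → T (lookup R (src e)) → T (lookup (step Γ s R) (tgt e))
    step-forward R e e∈s h =
      step-along R e (from T-∧ (e∈s , from T-∨ (inj₁ (from T-∧ (h , ==-refl (tgt e))))))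

    step-backward : ∀ R e → T (lookup s e) → T (lookup R (tgt e)) → T (lookup (step Γ s R) (src e))
    step-backward R e e∈s h =
      step-along R e (from T-∧ (e∈s , from T-∨ (inj₂ (from T-∧ (h , ==-refl (src e))))))

    private
      adjoins⁻ : ∀ R x e → T (adjoins R x e) →
                 T (lookup s e) × (T (lookup R (src e)) × tgt e ≡ x ⊎ T (lookup R (tgt e)) × src e ≡ x)
      adjoins⁻ R x e h with to (T-∧ {lookup s e}) h
      ... | e∈s , via with to (T-∨ {lookup R (src e) ∧ (tgt e == x)}) via
      ...   | inj₁ fwd = e∈s , inj₁ (map₂ ==⇒≡ (to (T-∧ {lookup R (src e)}) fwd))
      ...   | inj₂ bwd = e∈s , inj₂ (map₂ ==⇒≡ (to (T-∧ {lookup R (tgt e)}) bwd))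

    closed-absorbs-step : ∀ R C → Closed s C → (∀ x → T (lookup R x) → T (lookup C x)) →
                  ∀ x → T (lookup (step Γ s R) x) → T (lookup C x)
    closed-absorbs-step R C closed R⊆C x h with to (T-∨ {lookup R x}) (subst T (lookup-step R x) h)
    ... | inj₁ x∈R = R⊆C x x∈R
    ... | inj₂ adjoined with T-anyL⁻ (adjoins R x) edges adjoined
    ...   | e , e-adjoins with adjoins⁻ R x e e-adjoins
    ...     | e∈s , inj₁ (src∈R , refl) = subst T (closed e e∈s) (R⊆C (src e) src∈R)
    ...     | e∈s , inj₂ (tgt∈R , refl) = subst T (sym (closed e e∈s)) (R⊆C (tgt e) tgt∈R)

    fixed⇒closed : ∀ R → step Γ s R ≡ R → Closed s R
    fixed⇒closed R fixed e e∈s = T-ext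
      (λ h → subst (λ R′ → T (lookup R′ (tgt e))) fixed (step-forward R e e∈s h))
      (λ h → subst (λ R′ → T (lookup R′ (src e))) fixed (step-backward R e e∈s h))

    seed : Vertex → Subset (n Γ)
    seed u = tabulate (u ==_)

    private
      seed-root : ∀ u → T (lookup (seed u) u)
      seed-root u = subst T (sym (lookup∘tabulate (u ==_) u)) (==-refl u)

      iterate-keeps : ∀ j R {x} → T (lookup R x) → T (lookup (iterate j (step Γ s) R) x)
      iterate-keeps zero    R h = h
      iterate-keeps (suc j) R h = step-inflationary (iterate j (step Γ s) R) (iterate-keeps j R h)

      iterate-in-closed : ∀ C u → Closed s C → T (lookup C u) →
                          ∀ j x → T (lookup (iterate j (step Γ s) (seed u)) x) → T (lookup C x)
      iterate-in-closed C u closed u∈C zero x h =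
        subst (T ∘ lookup C) (==⇒≡ (subst T (lookup∘tabulate (u ==_) x) h)) u∈C
      iterate-in-closed C u closed u∈C (suc j) =
        closed-absorbs-step (iterate j (step Γ s) (seed u)) C closed (iterate-in-closed C u closed u∈C j)

    closed-absorbs-conn : ∀ C u v → Closed s C → T (lookup C u) → T (conn Γ s u v) → T (lookup C v)
    closed-absorbs-conn C u v closed u∈C = iterate-in-closed C u closed u∈C (n Γ) v

    conn-refl : ∀ u → T (conn Γ s u u)
    conn-refl u = iterate-keeps (n Γ) (seed u) (seed-root u)

    component-closed : ∀ u → Closed s (component Γ s u)
    component-closed u = fixed⇒closed (component Γ s u) (iterate-saturates (step Γ s)
      (λ R x∈R → T⇒∈ (step-inflationary R (∈⇒T x∈R))) (seed u) (u , T⇒∈ (seed-root u)))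

    conn-trans : ∀ u v w → T (conn Γ s u v) → T (conn Γ s v w) → T (conn Γ s u w)
    conn-trans u v w = closed-absorbs-conn (component Γ s u) v w (component-closed u)

    complement-closed : ∀ C → Closed s C → Closed s (∁ C)
    complement-closed C closed e e∈s =
      trans (lookup-map (src e) not C) (trans (cong not (closed e e∈s)) (sym (lookup-map (tgt e) not C)))

    -- The complement of the component of v is closed; if it contained u it would contain v.
    conn-sym : ∀ u v → T (conn Γ s u v) → T (conn Γ s v u)
    conn-sym u v uv with conn Γ s v u in vu
    ... | true  = tt
    ... | false = not-and-T (conn-refl v) (subst T (lookup-map v not (component Γ s v))
        (closed-absorbs-conn (∁ (component Γ s v)) u v
           (complement-closed (component Γ s v) (component-closed v)) u∈∁ uv))
      where
      u∈∁ : T (lookup (∁ (component Γ s v)) u)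
      u∈∁ = subst T (sym (trans (lookup-map u not (component Γ s v)) (cong not vu))) tt
      not-and-T : ∀ {b} → T b → T (not b) → ⊥
      not-and-T {true} _ ()

    conn-comm : ∀ u v → conn Γ s u v ≡ conn Γ s v u
    conn-comm u v = T-ext (conn-sym u v) (conn-sym v u)

    conn-along : ∀ x {e} → T (lookup s e) → conn Γ s x (src e) ≡ conn Γ s x (tgt e)
    conn-along x {e} e∈s = component-closed x e e∈s

  conn-mono : ∀ s s′ → (∀ e → T (lookup s e) → T (lookup s′ e)) →
              ∀ u v → T (conn Γ s u v) → T (conn Γ s′ u v)
  conn-mono s s′ s⊆s′ u v =
    closed-absorbs-conn s (component Γ s′ u) u v
      (λ e e∈s → component-closed s′ u e (s⊆s′ e e∈s)) (conn-refl s′ u)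

  conn-add-edge : ∀ s g a b → conn Γ (s [ g ]≔ true) a b ≡ joined (src g) (tgt g) (conn Γ s) a b
  conn-add-edge s g a b = T-ext forward backward
    where
    s′ : State Γ
    s′ = s [ g ]≔ true

    g∈s′ : T (lookup s′ g)
    g∈s′ = subst T (sym (lookup∘update g s true)) tt

    s⊆s′ : ∀ e → T (lookup s e) → T (lookup s′ e)
    s⊆s′ e e∈s with e ≟ᶠ g
    ... | yes refl = g∈s′
    ... | no  e≢g  = subst T (sym (lookup∘update′ e≢g s true)) e∈s

    lift : ∀ u v → T (conn Γ s u v) → T (conn Γ s′ u v)
    lift = conn-mono s s′ s⊆s′

    g-link : T (conn Γ s′ (src g) (tgt g))
    g-link = subst T (conn-along s′ (src g) g∈s′) (conn-refl s′ (src g))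

    J : Subset (n Γ)
    J = tabulate (joined (src g) (tgt g) (conn Γ s) a)

    J-closed : Closed s′ J
    J-closed e e∈s′ rewrite lookup∘tabulate (joined (src g) (tgt g) (conn Γ s) a) (src e)
                          | lookup∘tabulate (joined (src g) (tgt g) (conn Γ s) a) (tgt e) with e ≟ᶠ g
    ... | yes refl = joined-ends (conn Γ s) a (conn-refl s (src g)) (conn-refl s (tgt g))
    ... | no  e≢g  =
      joined-congʳ (conn Γ s) a (λ x → conn-along s x (subst T (lookup∘update′ e≢g s true) e∈s′))

    forward : T (conn Γ s′ a b) → T (joined (src g) (tgt g) (conn Γ s) a b)
    forward ab = subst T (lookup∘tabulate (joined (src g) (tgt g) (conn Γ s) a) b)
      (closed-absorbs-conn s′ J a b J-closed (subst T (sym (lookup∘tabulate (joined (src g) (tgt g) (conn Γ s) a) a))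
                                                (from T-∨ (inj₁ (conn-refl s a)))) ab)

    backward : T (joined (src g) (tgt g) (conn Γ s) a b) → T (conn Γ s′ a b)
    backward h with to (T-∨ {conn Γ s a b}) h
    ... | inj₁ ab = lift a b ab
    ... | inj₂ h′ with to (T-∨ {conn Γ s a (src g) ∧ conn Γ s (tgt g) b}) h′
    ...   | inj₁ via-src with to (T-∧ {conn Γ s a (src g)}) via-src
    ...     | a-src , tgt-b =
      conn-trans s′ a (tgt g) b (conn-trans s′ a (src g) (tgt g) (lift a (src g) a-src) g-link)
                 (lift (tgt g) b tgt-b)
    backward h | inj₂ h′ | inj₂ via-tgt with to (T-∧ {conn Γ s a (tgt g)}) via-tgt
    ...     | a-tgt , src-b =
      conn-trans s′ a (src g) b
                 (conn-trans s′ a (tgt g) (src g) (lift a (tgt g) a-tgt) (conn-sym s′ (src g) (tgt g) g-link))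
                 (lift (src g) b src-b)

  -- The terms T_e and U_e of d and Φ for a new edge between u and v, as lists of labellings.
  dAt ΦAt : State Γ → Labels Γ → Vertex → Vertex → List (Labels Γ)
  dAt s ℓ u v = when (conn Γ s u v ∨ not (lookup ℓ u ∧ lookup ℓ v))
                     (if conn Γ s u v then ℓ else relabel Γ s ℓ u v (lookup ℓ u ∨ lookup ℓ v))
  ΦAt s ℓ u v = when (not (conn Γ s u v) ∧ (lookup ℓ u ∧ lookup ℓ v)) (relabel Γ s ℓ u v false)

  dEdge ΦEdge : EState Γ → Edge → List (Labels Γ)
  dEdge (s , ℓ) e = if lookup s e then [] else dAt s ℓ (src e) (tgt e)
  ΦEdge (s , ℓ) e = if lookup s e then [] else ΦAt s ℓ (src e) (tgt e)

  twoStep : EState Γ → Edge → Edge → List (Labels Γ)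
  twoStep (s , ℓ) e f = concatMap (λ L → ΦEdge (s [ e ]≔ true , L) f) (dEdge (s , ℓ) e)
                     ++ concatMap (λ L → dEdge (s [ e ]≔ true , L) f) (ΦEdge (s , ℓ) e)

  lookup-relabel : ∀ s ℓ u v a x →
                   lookup (relabel Γ s ℓ u v a) x ≡ (if conn Γ s u x ∨ conn Γ s v x then a else lookup ℓ x)
  lookup-relabel s ℓ u v a x = lookup∘tabulate _ x

  -- Restriction to a few vertices

  record Restricts {P : Set} (ι : P → Vertex) (s : State Γ) (ℓ : Labels Γ) (σ : LocalState P) : Set where
    field
      linked-conn  : ∀ x y → conn Γ s (ι x) (ι y) ≡ linked σ x y
      label-lookup : ∀ x → lookup ℓ (ι x) ≡ label σ x

  module _ {P : Set} {ι : P → Vertex} {s s′ : State Γ} {ℓ : Labels Γ} {σ : LocalState P} {i j : P}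
           (R : Restricts ι s ℓ σ)
           (s′-joined : ∀ a b → conn Γ s′ a b ≡ joined (ι i) (ι j) (conn Γ s) a b) where
    open Restricts R

    private
      linked-joined : ∀ x y → conn Γ s′ (ι x) (ι y) ≡ joined i j (linked σ) x y
      linked-joined x y = trans (s′-joined (ι x) (ι y)) (cong₂ _∨_ (linked-conn x y)
        (cong₂ _∨_ (cong₂ _∧_ (linked-conn x i) (linked-conn j y))
                   (cong₂ _∧_ (linked-conn x j) (linked-conn i y))))

    dAt-restricts : Pointwise (Restricts ι s′) (dAt s ℓ (ι i) (ι j)) (dᴸ i j σ)
    dAt-restricts = when⁺ condition (record { linked-conn = linked-joined ; label-lookup = label-after })
      where
      condition : (conn Γ s (ι i) (ι j) ∨ not (lookup ℓ (ι i) ∧ lookup ℓ (ι j)))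
                ≡ (linked σ i j ∨ not (label σ i ∧ label σ j))
      condition rewrite linked-conn i j | label-lookup i | label-lookup j = refl
      label-after : ∀ x → lookup (if conn Γ s (ι i) (ι j) then ℓ
                                  else relabel Γ s ℓ (ι i) (ι j) (lookup ℓ (ι i) ∨ lookup ℓ (ι j))) (ι x)
                        ≡ (if linked σ i j then label σ x
                           else if linked σ i x ∨ linked σ j x then label σ i ∨ label σ j else label σ x)
      label-after x rewrite if-float (λ L → lookup L (ι x)) (conn Γ s (ι i) (ι j)) {ℓ}
                              {relabel Γ s ℓ (ι i) (ι j) (lookup ℓ (ι i) ∨ lookup ℓ (ι j))}
                          | lookup-relabel s ℓ (ι i) (ι j) (lookup ℓ (ι i) ∨ lookup ℓ (ι j)) (ι x)
                          | linked-conn i j | linked-conn i x | linked-conn j x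
                          | label-lookup i | label-lookup j | label-lookup x = refl

    ΦAt-restricts : Pointwise (Restricts ι s′) (ΦAt s ℓ (ι i) (ι j)) (Φᴸ i j σ)
    ΦAt-restricts = when⁺ condition (record { linked-conn = linked-joined ; label-lookup = label-after })
      where
      condition : (not (conn Γ s (ι i) (ι j)) ∧ (lookup ℓ (ι i) ∧ lookup ℓ (ι j)))
                ≡ (not (linked σ i j) ∧ (label σ i ∧ label σ j))
      condition rewrite linked-conn i j | label-lookup i | label-lookup j = refl
      label-after : ∀ x → lookup (relabel Γ s ℓ (ι i) (ι j) false) (ι x)
                        ≡ (if linked σ i x ∨ linked σ j x then false else label σ x)
      label-after x rewrite lookup-relabel s ℓ (ι i) (ι j) false (ι x)
                          | linked-conn i x | linked-conn j x | label-lookup x = refl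

  module _ {P : Set} {ι : P → Vertex} {s : State Γ} {ℓ : Labels Γ} {σ : LocalState P} {i j : P} {e : Edge}
           (e∉s : lookup s e ≡ false) (R : Restricts ι s ℓ σ)
           (i↦src : ι i ≡ src e) (j↦tgt : ι j ≡ tgt e) where

    private
      s+e-joined : ∀ a b → conn Γ (s [ e ]≔ true) a b ≡ joined (ι i) (ι j) (conn Γ s) a b
      s+e-joined rewrite i↦src | j↦tgt = conn-add-edge s e

    dEdge-restricts : Pointwise (Restricts ι (s [ e ]≔ true)) (dEdge (s , ℓ) e) (dᴸ i j σ)
    dEdge-restricts rewrite e∉s | sym i↦src | sym j↦tgt = dAt-restricts R s+e-joined

    ΦEdge-restricts : Pointwise (Restricts ι (s [ e ]≔ true)) (ΦEdge (s , ℓ) e) (Φᴸ i j σ)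
    ΦEdge-restricts rewrite e∉s | sym i↦src | sym j↦tgt = ΦAt-restricts R s+e-joined

  twoStep-restricts : ∀ {P} {ι : P → Vertex} {s ℓ σ} {i j i′ j′ : P} {e f} →
    lookup s e ≡ false → lookup (s [ e ]≔ true) f ≡ false → Restricts ι s ℓ σ →
    ι i ≡ src e → ι j ≡ tgt e → ι i′ ≡ src f → ι j′ ≡ tgt f →
    Pointwise (Restricts ι ((s [ e ]≔ true) [ f ]≔ true)) (twoStep (s , ℓ) e f) (twoStepᴸ i j i′ j′ σ)
  twoStep-restricts e∉s f∉s+e R i↦ j↦ i′↦ j′↦ =
    ++⁺ (concatMap⁺ (λ R′ → ΦEdge-restricts f∉s+e R′ i′↦ j′↦) (dEdge-restricts e∉s R i↦ j↦))
        (concatMap⁺ (λ R′ → dEdge-restricts f∉s+e R′ i′↦ j′↦) (ΦEdge-restricts e∉s R i↦ j↦))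

  restricts-labels : ∀ {P} {ι : P → Vertex} {s Ls σs} → Pointwise (λ L σ → Restricts ι s L σ) Ls σs →
                     ∀ x → map (λ L → lookup L (ι x)) Ls ≡ map (λ σ → label σ x) σs
  restricts-labels rs x = Pointwise-≡⇒≡ (map⁺ _ _ (Pointwise.map (λ R → Restricts.label-lookup R x) rs))

  restricts-consistent : ∀ {P} {ι : P → Vertex} {s ℓ σ} →
                         ValidE Γ (s , ℓ) → Restricts ι s ℓ σ → Consistent σ
  restricts-consistent {ι = ι} {s} {ℓ} {σ} valid R =
    (λ x y z xy yz → subst T (linked-conn x z) (conn-trans s (ι x) (ι y) (ι z)
                       (subst T (sym (linked-conn x y)) xy) (subst T (sym (linked-conn y z)) yz))) ,
    (λ x y xy → trans (sym (label-lookup x))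
                      (trans (valid (ι x) (ι y) (subst T (sym (linked-conn x y)) xy)) (label-lookup y)))
    where open Restricts R

  restricts-extend⁻ : ∀ {P} {ι : Maybe P → Vertex} {s ℓ σ lw ℓw} →
                      Restricts ι s ℓ (extend σ lw ℓw) → Restricts (ι ∘ just) s ℓ σ
  restricts-extend⁻ R = record { linked-conn  = λ x y → linked-conn (just x) (just y)
                               ; label-lookup = λ x → label-lookup (just x) }
    where open Restricts R

  module Snapshot (s : State Γ) (ℓ : Labels Γ) (e f : Edge) (w : Vertex) where

    corner : Corner → Vertex
    corner (just e₁) = src e
    corner (just e₂) = tgt e
    corner (just f₁) = src f
    corner (just f₂) = tgt f
    corner nothing   = w

    frameBits : Vec Bool 10
    frameBits = c (src e) (tgt e) ∷ c (src e) (src f) ∷ c (src e) (tgt f)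
              ∷ c (tgt e) (src f) ∷ c (tgt e) (tgt f) ∷ c (src f) (tgt f)
              ∷ lookup ℓ (src e) ∷ lookup ℓ (tgt e) ∷ lookup ℓ (src f) ∷ lookup ℓ (tgt f) ∷ []
      where c = conn Γ s

    probeBits : Vec Bool 5
    probeBits = c (src e) w ∷ c (tgt e) w ∷ c (src f) w ∷ c (tgt f) w ∷ lookup ℓ w ∷ []
      where c = conn Γ s

    snapshot : LocalState Corner
    snapshot = probeOf (frameOf frameBits) probeBits

    snapshot-restricts : Restricts corner s ℓ snapshot
    snapshot-restricts = record { linked-conn = linked-conn′ ; label-lookup = label-lookup′ }
      where
      diagonal : ∀ u → conn Γ s u u ≡ true
      diagonal u = to T-≡ (conn-refl s u)
      swapped : ∀ u v → conn Γ s u v ≡ conn Γ s v u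
      swapped = conn-comm s
      linked-conn′ : ∀ x y → conn Γ s (corner x) (corner y) ≡ linked snapshot x y
      linked-conn′ (just e₁) (just e₁) = diagonal _
      linked-conn′ (just e₁) (just e₂) = refl
      linked-conn′ (just e₁) (just f₁) = refl
      linked-conn′ (just e₁) (just f₂) = refl
      linked-conn′ (just e₁) nothing   = refl
      linked-conn′ (just e₂) (just e₁) = swapped _ _
      linked-conn′ (just e₂) (just e₂) = diagonal _
      linked-conn′ (just e₂) (just f₁) = refl
      linked-conn′ (just e₂) (just f₂) = refl
      linked-conn′ (just e₂) nothing   = refl
      linked-conn′ (just f₁) (just e₁) = swapped _ _
      linked-conn′ (just f₁) (just e₂) = swapped _ _
      linked-conn′ (just f₁) (just f₁) = diagonal _
      linked-conn′ (just f₁) (just f₂) = refl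
      linked-conn′ (just f₁) nothing   = refl
      linked-conn′ (just f₂) (just e₁) = swapped _ _
      linked-conn′ (just f₂) (just e₂) = swapped _ _
      linked-conn′ (just f₂) (just f₁) = swapped _ _
      linked-conn′ (just f₂) (just f₂) = diagonal _
      linked-conn′ (just f₂) nothing   = refl
      linked-conn′ nothing   (just e₁) = swapped _ _
      linked-conn′ nothing   (just e₂) = swapped _ _
      linked-conn′ nothing   (just f₁) = swapped _ _
      linked-conn′ nothing   (just f₂) = swapped _ _
      linked-conn′ nothing   nothing   = diagonal _
      label-lookup′ : ∀ x → lookup ℓ (corner x) ≡ label snapshot x
      label-lookup′ (just e₁) = refl
      label-lookup′ (just e₂) = refl
      label-lookup′ (just f₁) = refl
      label-lookup′ (just f₂) = refl
      label-lookup′ nothing   = refl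

  twoStep-comm : ∀ {s ℓ e f} → ValidE Γ (s , ℓ) → lookup s e ≡ false → lookup s f ≡ false → e ≢ f →
                 twoStep (s , ℓ) e f ≡ twoStep (s , ℓ) f e
  twoStep-comm {s} {ℓ} {e} {f} valid e∉s f∉s e≢f = columns-injective (src e) λ w →
    let open Snapshot s ℓ e f w in begin
      map (λ L → lookup L w) (twoStep (s , ℓ) e f)
        ≡⟨ restricts-labels (twoStep-restricts {i = just e₁} {just e₂} {just f₁} {just f₂}
             e∉s (stays-fresh f∉s (e≢f ∘ sym)) snapshot-restricts refl refl refl refl) nothing ⟩
      probeLabels (twoStepᴸ (just e₁) (just e₂) (just f₁) (just f₂) snapshot)
        ≡⟨ twoStepᴸ-comm frameBits (restricts-consistent valid (restricts-extend⁻ snapshot-restricts))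
                         probeBits (restricts-consistent valid snapshot-restricts) ⟩
      probeLabels (twoStepᴸ (just f₁) (just f₂) (just e₁) (just e₂) snapshot)
        ≡⟨ restricts-labels (twoStep-restricts {i = just f₁} {just f₂} {just e₁} {just e₂}
             f∉s (stays-fresh e∉s e≢f) snapshot-restricts refl refl refl refl) nothing ⟨
      map (λ L → lookup L w) (twoStep (s , ℓ) f e) ∎
    where
    stays-fresh : ∀ {g h} → lookup s h ≡ false → h ≢ g → lookup (s [ g ]≔ true) h ≡ false
    stays-fresh h∉s h≢g = trans (lookup∘update′ h≢g s true) h∉s

  -- Expanding Φ ∘ d and d ∘ Φ on a basis state

  linear : (EState Γ → Cochain Γ) → Cochain Γ → Cochain Γ
  linear F = concatMap (λ qS → scale {Γ} (proj₁ qS) (F (proj₂ qS)))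

  pairing-linear : ∀ g F c → ⟨ g ∣ linear F c ⟩ ≡ ⟨ (λ S → ⟨ g ∣ F S ⟩) ∣ c ⟩
  pairing-linear g F c = trans (∑-concatMap _ c _) (∑-cong c λ qS → trans (∑-map _ (F (proj₂ qS)) _)
    (trans (∑-cong (F (proj₂ qS)) (λ rS → *-assoc (proj₁ qS) (proj₁ rS) _))
           (∑-*ˡ (proj₁ qS) (F (proj₂ qS)) _)))

  pairing-linear₂ : ∀ g F G c → ⟨ g ∣ linear G (linear F c) ⟩ ≡ ⟨ (λ S → ⟨ g ∣ linear G (F S) ⟩) ∣ c ⟩
  pairing-linear₂ g F G c = trans (pairing-linear g G (linear F c)) (trans (pairing-linear _ F c)
    (pairing-cong c (λ S → sym (pairing-linear g G (F S)))))

  δ : EState Γ → EState Γ → ℚ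
  δ T S = if does (_≟E_ {Γ} S T) then 1ℚ else 0ℚ

  coeff≡pairing : ∀ T c → coeff {Γ} T c ≡ ⟨ δ T ∣ c ⟩
  coeff≡pairing T []            = refl
  coeff≡pairing T ((q , S) ∷ c) = cong₂ _+_ (if-as-product (does (_≟E_ {Γ} S T))) (coeff≡pairing T c)
    where
    if-as-product : ∀ b → (if b then q else 0ℚ) ≡ q * (if b then 1ℚ else 0ℚ)
    if-as-product true  = sym (*-identityʳ q)
    if-as-product false = sym (*-zeroʳ q)

  signedAt : State Γ → Edge → List (Labels Γ) → Cochain Γ
  signedAt s e = map (λ L → sgn (count< s e) , (s [ e ]≔ true) , L)

  dTerm-signed : ∀ s ℓ e → dTerm Γ (s , ℓ) e ≡ signedAt s e (dEdge (s , ℓ) e)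
  dTerm-signed s ℓ e with lookup s e
  ... | true = refl
  ... | false with conn Γ s (src e) (tgt e)
  ...   | true = refl
  ...   | false with lookup ℓ (src e) ∧ lookup ℓ (tgt e)
  ...     | true  = refl
  ...     | false = refl

  ΦTerm-signed : ∀ s ℓ e → ΦTerm Γ (s , ℓ) e ≡ signedAt s e (ΦEdge (s , ℓ) e)
  ΦTerm-signed s ℓ e with lookup s e
  ... | true = refl
  ... | false with conn Γ s (src e) (tgt e)
  ...   | true = refl
  ...   | false with lookup ℓ (src e) ∧ lookup ℓ (tgt e)
  ...     | true  = refl
  ...     | false = refl

  module _ (term : EState Γ → Edge → Cochain Γ) (A : EState Γ → Edge → List (Labels Γ))
           (term-signed : ∀ s ℓ e → term (s , ℓ) e ≡ signedAt s e (A (s , ℓ) e)) where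

    pairing-edgeSum : ∀ g s ℓ → ⟨ g ∣ concatMap (term (s , ℓ)) edges ⟩
                              ≡ ∑[ e ∈ edges ] sgn (count< s e) * (∑[ L ∈ A (s , ℓ) e ] g (s [ e ]≔ true , L))
    pairing-edgeSum g s ℓ = trans (∑-concatMap (term (s , ℓ)) edges _) (∑-cong edges λ e →
      trans (cong ⟨ g ∣_⟩ (term-signed s ℓ e))
            (trans (∑-map _ (A (s , ℓ) e) _) (∑-*ˡ (sgn (count< s e)) (A (s , ℓ) e) _)))

  module _ (term₁ term₂ : EState Γ → Edge → Cochain Γ) (A₁ A₂ : EState Γ → Edge → List (Labels Γ))
           (term₁-signed : ∀ s ℓ e → term₁ (s , ℓ) e ≡ signedAt s e (A₁ (s , ℓ) e))
           (term₂-signed : ∀ s ℓ e → term₂ (s , ℓ) e ≡ signedAt s e (A₂ (s , ℓ) e)) where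

    pairing-composite : ∀ g s ℓ →
      ⟨ g ∣ linear (λ S → concatMap (term₂ S) edges) (concatMap (term₁ (s , ℓ)) edges) ⟩
      ≡ ∑[ e ∈ edges ] ∑[ f ∈ edges ] pairSign s e f *
          (∑[ L ∈ concatMap (λ L → A₂ (s [ e ]≔ true , L) f) (A₁ (s , ℓ) e) ]
             g ((s [ e ]≔ true) [ f ]≔ true , L))
    pairing-composite g s ℓ = begin
      ⟨ g ∣ linear F₂ (concatMap (term₁ (s , ℓ)) edges) ⟩
        ≡⟨ pairing-linear g F₂ (concatMap (term₁ (s , ℓ)) edges) ⟩
      ⟨ (λ S → ⟨ g ∣ F₂ S ⟩) ∣ concatMap (term₁ (s , ℓ)) edges ⟩
        ≡⟨ pairing-edgeSum term₁ A₁ term₁-signed _ s ℓ ⟩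
      ∑[ e ∈ edges ] sgn (count< s e) * (∑[ L ∈ A₁ (s , ℓ) e ] ⟨ g ∣ F₂ (s [ e ]≔ true , L) ⟩)
        ≡⟨ ∑-cong edges (λ e → cong (sgn (count< s e) *_) (second-step e)) ⟩
      ∑[ e ∈ edges ] sgn (count< s e) * (∑[ f ∈ edges ] sgn (count< (s [ e ]≔ true) f) * N e f)
        ≡⟨ ∑-cong edges (λ e → trans (sym (∑-*ˡ (sgn (count< s e)) edges _))
                                     (∑-cong edges (λ f → sym (*-assoc (sgn (count< s e)) _ (N e f))))) ⟩
      ∑[ e ∈ edges ] ∑[ f ∈ edges ] pairSign s e f * N e f
        ∎
      where
      F₂ : EState Γ → Cochain Γ
      F₂ S = concatMap (term₂ S) edges
      N : Edge → Edge → ℚ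
      N e f = ∑[ L ∈ concatMap (λ L → A₂ (s [ e ]≔ true , L) f) (A₁ (s , ℓ) e) ]
                g ((s [ e ]≔ true) [ f ]≔ true , L)
      second-step : ∀ e → ∑[ L ∈ A₁ (s , ℓ) e ] ⟨ g ∣ F₂ (s [ e ]≔ true , L) ⟩
                        ≡ ∑[ f ∈ edges ] sgn (count< (s [ e ]≔ true) f) * N e f
      second-step e = begin
        ∑[ L ∈ A₁ (s , ℓ) e ] ⟨ g ∣ F₂ (s [ e ]≔ true , L) ⟩
          ≡⟨ ∑-cong (A₁ (s , ℓ) e) (λ L → pairing-edgeSum term₂ A₂ term₂-signed g (s [ e ]≔ true) L) ⟩
        ∑[ L ∈ A₁ (s , ℓ) e ] ∑[ f ∈ edges ] sgn (count< (s [ e ]≔ true) f) * M L f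
          ≡⟨ ∑-swap (A₁ (s , ℓ) e) edges _ ⟩
        ∑[ f ∈ edges ] ∑[ L ∈ A₁ (s , ℓ) e ] sgn (count< (s [ e ]≔ true) f) * M L f
          ≡⟨ ∑-cong edges (λ f → trans (∑-*ˡ (sgn (count< (s [ e ]≔ true) f)) (A₁ (s , ℓ) e) (λ L → M L f))
                                       (cong (sgn (count< (s [ e ]≔ true) f) *_)
                                             (sym (∑-concatMap _ (A₁ (s , ℓ) e) _)))) ⟩
        ∑[ f ∈ edges ] sgn (count< (s [ e ]≔ true) f) * N e f
          ∎
        where
        M : Labels Γ → Edge → ℚ
        M L f = ∑[ L′ ∈ A₂ (s [ e ]≔ true , L) f ] g ((s [ e ]≔ true) [ f ]≔ true , L′)

  twoStep-absorbed : ∀ {s ℓ e f} → lookup s e ≡ true ⊎ lookup (s [ e ]≔ true) f ≡ true →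
                     twoStep (s , ℓ) e f ≡ []
  twoStep-absorbed (inj₁ e∈s) rewrite e∈s = refl
  twoStep-absorbed {s} {ℓ} {e} {f} (inj₂ f∈s+e) = cong₂ _++_
    (concatMap-[] (λ L → cong (λ b → if b then [] else ΦAt (s [ e ]≔ true) L (src f) (tgt f)) f∈s+e)
                  (dEdge (s , ℓ) e))
    (concatMap-[] (λ L → cong (λ b → if b then [] else dAt (s [ e ]≔ true) L (src f) (tgt f)) f∈s+e)
                  (ΦEdge (s , ℓ) e))

  module _ (g : EState Γ → ℚ) (s : State Γ) (ℓ : Labels Γ) where

    weigh : List (Labels Γ) → Edge → Edge → ℚ
    weigh Ls e f = ∑[ L ∈ Ls ] g ((s [ e ]≔ true) [ f ]≔ true , L)

    pairTerm : Edge → Edge → ℚ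
    pairTerm e f = pairSign s e f * weigh (twoStep (s , ℓ) e f) e f

    private
      vanishing : ∀ e f → lookup s e ≡ true ⊎ lookup (s [ e ]≔ true) f ≡ true →
                          lookup s f ≡ true ⊎ lookup (s [ f ]≔ true) e ≡ true → pairTerm e f ≡ - pairTerm f e
      vanishing e f ef-absorbed fe-absorbed
        rewrite twoStep-absorbed {s} {ℓ} {e} {f} ef-absorbed | twoStep-absorbed {s} {ℓ} {f} {e} fe-absorbed =
        trans (*-zeroʳ (pairSign s e f)) (sym (cong -_ (*-zeroʳ (pairSign s f e))))

    pairTerm-antisym : ValidE Γ (s , ℓ) → ∀ e f → pairTerm e f ≡ - pairTerm f e
    pairTerm-antisym valid e f with e ≟ᶠ f
    ... | yes refl = vanishing e e (inj₂ (lookup∘update e s true)) (inj₂ (lookup∘update e s true))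
    ... | no e≢f with true-or-false (lookup s e) | true-or-false (lookup s f)
    ...   | inj₁ e∈s | _        = vanishing e f (inj₁ e∈s) (inj₂ (trans (lookup∘update′ e≢f s true) e∈s))
    ...   | inj₂ _   | inj₁ f∈s =
      vanishing e f (inj₂ (trans (lookup∘update′ (e≢f ∘ sym) s true) f∈s)) (inj₁ f∈s)
    ...   | inj₂ e∉s | inj₂ f∉s = begin
      pairSign s e f * weigh (twoStep (s , ℓ) e f) e f
        ≡⟨ cong₂ _*_ (pairSign-antisym {s = s} e∉s f∉s e≢f)
                     (cong₂ (λ Ls t → ∑[ L ∈ Ls ] g (t , L)) (twoStep-comm {s} {ℓ} valid e∉s f∉s e≢f)
                                                            ([]≔-commutes s e f e≢f)) ⟩
      - pairSign s f e * weigh (twoStep (s , ℓ) f e) f e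
        ≡⟨ neg-distribˡ-* (pairSign s f e) _ ⟨
      - pairTerm f e ∎

  anticommute-basis : ∀ S → ValidE Γ S → ∀ g →
                      ⟨ g ∣ Φ Γ (dBasis Γ S) ⟩ + ⟨ g ∣ d Γ (ΦBasis Γ S) ⟩ ≡ 0ℚ
  anticommute-basis (s , ℓ) valid g = begin
    ⟨ g ∣ Φ Γ (dBasis Γ (s , ℓ)) ⟩ + ⟨ g ∣ d Γ (ΦBasis Γ (s , ℓ)) ⟩
      ≡⟨ cong₂ _+_ (pairing-composite (dTerm Γ) (ΦTerm Γ) dEdge ΦEdge dTerm-signed ΦTerm-signed g s ℓ)
                   (pairing-composite (ΦTerm Γ) (dTerm Γ) ΦEdge dEdge ΦTerm-signed dTerm-signed g s ℓ) ⟩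
    (∑[ e ∈ edges ] ∑[ f ∈ edges ] pairSign s e f * weigh g s ℓ (Φd e f) e f)
      + (∑[ e ∈ edges ] ∑[ f ∈ edges ] pairSign s e f * weigh g s ℓ (dΦ e f) e f)
      ≡⟨ ∑-+ edges _ _ ⟨
    ∑[ e ∈ edges ] ((∑[ f ∈ edges ] pairSign s e f * weigh g s ℓ (Φd e f) e f)
                    + (∑[ f ∈ edges ] pairSign s e f * weigh g s ℓ (dΦ e f) e f))
      ≡⟨ ∑-cong edges (λ e → trans (sym (∑-+ edges _ _)) (∑-cong edges (merge e))) ⟩
    ∑[ e ∈ edges ] ∑[ f ∈ edges ] pairTerm g s ℓ e f
      ≡⟨ ∑-antisym edges (pairTerm g s ℓ) (pairTerm-antisym g s ℓ valid) ⟩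
    0ℚ ∎
    where
    Φd dΦ : Edge → Edge → List (Labels Γ)
    Φd e f = concatMap (λ L → ΦEdge (s [ e ]≔ true , L) f) (dEdge (s , ℓ) e)
    dΦ e f = concatMap (λ L → dEdge (s [ e ]≔ true , L) f) (ΦEdge (s , ℓ) e)

    merge : ∀ e f → pairSign s e f * weigh g s ℓ (Φd e f) e f + pairSign s e f * weigh g s ℓ (dΦ e f) e f
                  ≡ pairTerm g s ℓ e f
    merge e f = trans (sym (*-distribˡ-+ (pairSign s e f) _ _))
                      (cong (pairSign s e f *_) (sym (∑-++ (Φd e f) (dΦ e f) _)))

mainTheorem2 : (Γ : Graph) (c : Cochain Γ) → ValidC Γ c →
    (T : EState Γ) → coeff {Γ} T (Φ Γ (d Γ c) ++ d Γ (Φ Γ c)) ≡ 0ℚ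
mainTheorem2 Γ c valid T = begin
  coeff T (Φ Γ (d Γ c) ++ d Γ (Φ Γ c))
    ≡⟨ coeff≡pairing Γ T (Φ Γ (d Γ c) ++ d Γ (Φ Γ c)) ⟩
  ⟨ δ Γ T ∣ Φ Γ (d Γ c) ++ d Γ (Φ Γ c) ⟩
    ≡⟨ pairing-++ (δ Γ T) (Φ Γ (d Γ c)) _ ⟩
  ⟨ δ Γ T ∣ Φ Γ (d Γ c) ⟩ + ⟨ δ Γ T ∣ d Γ (Φ Γ c) ⟩
    ≡⟨ cong₂ _+_ (pairing-linear₂ Γ (δ Γ T) (dBasis Γ) (ΦBasis Γ) c)
                 (pairing-linear₂ Γ (δ Γ T) (ΦBasis Γ) (dBasis Γ) c) ⟩
  ⟨ (λ S → ⟨ δ Γ T ∣ Φ Γ (dBasis Γ S) ⟩) ∣ c ⟩ + ⟨ (λ S → ⟨ δ Γ T ∣ d Γ (ΦBasis Γ S) ⟩) ∣ c ⟩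
    ≡⟨ pairing-+ c _ _ ⟨
  ⟨ (λ S → ⟨ δ Γ T ∣ Φ Γ (dBasis Γ S) ⟩ + ⟨ δ Γ T ∣ d Γ (ΦBasis Γ S) ⟩) ∣ c ⟩
    ≡⟨ pairing-vanishes (All.map (λ {qS} valid-qS → anticommute-basis Γ (proj₂ qS) valid-qS (δ Γ T)) valid) ⟩
  0ℚ ∎
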